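{- Let $G$ be a connected graph with vertex set $\{1,\dots,n\}$, $n\ge 2$, let $\Phi=(F_1,\dots,F_n)$ be an $n$-tuple of pairwise disjoint graphs, and let $G[\Phi]$ be the generalized lexicographic product. Then $\gamma(G)\le\gamma(G[\Phi])$. Equality holds if and only if there is a minimum dominating set $I$ of $G$ such that for every vertex $j\in I$ which is an isolated vertex of the induced subgraph $\langle I\rangle$ we have $\gamma(F_j)=1$. Moreover, if $\gamma(G)=\gamma(G[\Phi])$, then $|D\cap V(F_i)|\le 1$ for all $i=1,\dots,n$ and every minimum dominating set $D$ of $G[\Phi]$.
   Context: All graphs are finite, simple and undirected. The generalized lexicographic product $G[\Phi]$ is the graph with vertex set $\bigcup_{i=1}^n V(F_i)$ in which each $F_i$ is an induced subgraph, and for $x\in V(F_i)$, $y\in V(F_j)$ with $i\neq j$, $xy$ is an edge iff $ij\in E(G)$. A dominating set of a graph $H$ is a set $D\subseteq V(H)$ such that every vertex not in $D$ has a neighbor in $D$; $\gamma(H)$ is the minimum cardinality of a dominating set. -}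

module Defs where

open import Level using (0ℓ)
open import Data.Nat using (ℕ; suc; _≤_)
open import Data.Fin using (Fin; _≟_)
open import Data.Product using (Σ; Σ-syntax; ∃; _×_; _,_; proj₁)
open import Data.Sum using (_⊎_)
open import Data.List using (List; length; filter)
open import Data.List.Membership.Propositional using (_∈_)
open import Data.List.Relation.Unary.Unique.Propositional using (Unique)
open import Relation.Nullary using (¬_)
open import Relation.Binary.PropositionalEquality using (_≡_)
open import Function.Bundles using (_⇔_)

record Graph (V : Set) : Set₁ where
  field
    Adj    : V → V → Set
    sym    : ∀ {x y} → Adj x y → Adj y x
    irrefl : ∀ {x} → ¬ Adj x x
open Graph public

-- Vertex sets are represented by duplicate-free lists; |D| = length D.
-- D is a dominating set of H.
Dominating : {V : Set} → Graph V → List V → Set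
Dominating {V} H D = Unique D × ((v : V) → v ∈ D ⊎ Σ[ u ∈ V ] (u ∈ D × Adj H u v))

MinDominating : {V : Set} → Graph V → List V → Set
MinDominating {V} H D =
  Dominating H D × ((D′ : List V) → Dominating H D′ → length D ≤ length D′)

IsDomNumber : {V : Set} → Graph V → ℕ → Set
IsDomNumber {V} H k = Σ[ D ∈ List V ] (MinDominating H D × length D ≡ k)

data Reach {V : Set} (G : Graph V) : V → V → Set where
  here : ∀ {x} → Reach G x x
  step : ∀ {x y z} → Adj G x y → Reach G y z → Reach G x z

Connected : {V : Set} → Graph V → Set
Connected {V} G = (x y : V) → Reach G x y

-- Generalized lexicographic product G[Φ]; F i has vertex set Fin (m i),
-- and V(G[Φ]) = disjoint union Σ i. V(F i).
LexV : (n : ℕ) (m : Fin n → ℕ) → Set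
LexV n m = Σ (Fin n) (λ i → Fin (m i))

data LexAdj {n : ℕ} {m : Fin n → ℕ} (G : Graph (Fin n))
            (F : (i : Fin n) → Graph (Fin (m i))) : LexV n m → LexV n m → Set where
  inner : ∀ {i x y} → Adj (F i) x y → LexAdj G F (i , x) (i , y)
  outer : ∀ {i j x y} → Adj G i j → LexAdj G F (i , x) (j , y)

lexSym : ∀ {n} {m : Fin n → ℕ} (G : Graph (Fin n)) (F : (i : Fin n) → Graph (Fin (m i))) →
         ∀ {u v} → LexAdj G F u v → LexAdj G F v u
lexSym G F (inner {i} a) = inner (sym (F i) a)
lexSym G F (outer a) = outer (sym G a)

lexIrrefl : ∀ {n} {m : Fin n → ℕ} (G : Graph (Fin n)) (F : (i : Fin n) → Graph (Fin (m i))) →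
            ∀ {u} → ¬ LexAdj G F u u
lexIrrefl G F (inner {i} a) = irrefl (F i) a
lexIrrefl G F (outer a) = irrefl G a

Lex : {n : ℕ} {m : Fin n → ℕ} (G : Graph (Fin n))
      (F : (i : Fin n) → Graph (Fin (m i))) → Graph (LexV n m)
Lex {n} {m} G F = record { Adj = LexAdj G F ; sym = lexSym {n} {m} G F ; irrefl = lexIrrefl {n} {m} G F }

IsolatedIn : {V : Set} → Graph V → List V → V → Set
IsolatedIn {V} G I j = j ∈ I × ((k : V) → k ∈ I → ¬ Adj G j k)

slice : ∀ {n} {m : Fin n → ℕ} → Fin n → List (LexV n m) → List (LexV n m)
slice i D = filter (λ v → proj₁ v ≟ i) D

-- A dominating set D of G[Φ] projects onto a dominating set of G: a vertex (i , x) is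
-- dominated either from its own fibre, which puts i in the projection, or from a fibre
-- over a neighbour of i.  Hence γ(G) ≤ γ(G[Φ]), and if equality holds the projection of a
-- minimum D is injective (else deduplicating it would beat γ(G)), so D meets each fibre at
-- most once and its projection I is a minimum dominating set of G.  A vertex j isolated in
-- ⟨I⟩ can then only be dominated inside its own fibre, by the unique vertex d of D over j,
-- so γ(F j) = 1.  Conversely such an I lifts to a dominating set of G[Φ] of size |I|: over
-- an isolated j take a universal vertex of F j, over any other j an arbitrary vertex.
module Submission where

open import Defs
open import Data.Nat using (ℕ; _≤_; _<_; _≤?_; z≤n; s≤s)
open import Data.Nat.Properties using (≤-trans; ≤-reflexive; ≤-antisym; <-irrefl; n<1+n; module ≤-Reasoning)
open import Data.Fin using (Fin; fromℕ<)
import Data.Fin as Fin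
open import Data.Fin.Properties using (sequence)
open import Data.Product using (Σ-syntax; _×_; _,_; proj₁; proj₂)
import Data.Product as Product
open import Data.Product.Properties.WithK using (,-injectiveʳ)
open import Data.Sum using (_⊎_; inj₁; inj₂)
import Data.Sum as Sum
open import Data.Empty using (⊥-elim)
open import Data.List using (List; []; _∷_; length; map; filter; deduplicate)
open import Data.List.Properties using (length-map; length-deduplicate; filter-none)
open import Data.List.Membership.Propositional using (_∈_; mapWith∈)
open import Data.List.Membership.Propositional.Properties
  using (∈-map⁺; ∈-map⁻; ∈-deduplicate⁺; map-mapWith∈; mapWith∈-id)
import Data.List.Membership.Setoid.Properties as SetoidMembership
import Data.List.Membership.DecPropositional as DecMembership
open import Data.List.Relation.Binary.Subset.Propositional using (_⊆_)
open import Data.List.Relation.Binary.Subset.Propositional.Properties using (∷⁺ʳ)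
open import Data.List.Relation.Unary.Any using (here; there)
import Data.List.Relation.Unary.Any.Properties as Any
import Data.List.Relation.Unary.All as All
import Data.List.Relation.Unary.All.Properties as All
open import Data.List.Relation.Unary.Unique.Propositional using (Unique; []; _∷_)
import Data.List.Relation.Unary.Unique.DecPropositional.Properties as UniqueDec
open import Data.List.Relation.Unary.Unique.Propositional.Properties using (map⁻)
open import Effect.Monad using (RawMonad)
open import Relation.Nullary using (Dec; yes; no)
open import Relation.Nullary.Decidable using (decidable-stable; ¬¬-excluded-middle)
open import Relation.Nullary.Negation using (¬¬-Monad; ¬¬-map)
open import Relation.Binary.Definitions using (DecidableEquality)
open import Relation.Binary.PropositionalEquality
  using (_≡_; refl; cong; trans; subst; ≢-sym; setoid) renaming (sym to ≡-sym)
open import Function.Bundles using (_⇔_; mk⇔)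

module _ {A : Set} (_≟_ : DecidableEquality A) where
  open DecMembership _≟_ using (_∈?_)

  unique⊎shorter-superset : (xs : List A) →
    Unique xs ⊎ Σ[ ys ∈ List A ] (xs ⊆ ys × length ys < length xs)
  unique⊎shorter-superset [] = inj₁ []
  unique⊎shorter-superset (x ∷ xs) with x ∈? xs
  ... | yes x∈xs = inj₂ (xs , (λ { (here refl) → x∈xs ; (there p) → p }) , n<1+n _)
  ... | no x∉xs with unique⊎shorter-superset xs
  ...   | inj₁ u = inj₁ (All.¬Any⇒All¬ xs x∉xs ∷ u)
  ...   | inj₂ (ys , xs⊆ys , ys<xs) = inj₂ (x ∷ ys , ∷⁺ʳ x xs⊆ys , s≤s ys<xs)

module _ {A B : Set} (f : A → B) where

  unique-map⇒injectiveOn : ∀ {xs x y} → Unique (map f xs) → x ∈ xs → y ∈ xs → f x ≡ f y → x ≡ y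
  unique-map⇒injectiveOn _ (here refl) (here refl) _ = refl
  unique-map⇒injectiveOn (x∉ ∷ _) (here refl) (there y∈) e = ⊥-elim (All.lookup x∉ (∈-map⁺ f y∈) e)
  unique-map⇒injectiveOn (y∉ ∷ _) (there x∈) (here refl) e = ⊥-elim (All.lookup y∉ (∈-map⁺ f x∈) (≡-sym e))
  unique-map⇒injectiveOn (_ ∷ u) (there x∈) (there y∈) e = unique-map⇒injectiveOn u x∈ y∈ e

  length-filter-unique-map≤1 : (_≟_ : DecidableEquality B) (b : B) (xs : List A) →
    Unique (map f xs) → length (filter (λ v → f v ≟ b) xs) ≤ 1
  length-filter-unique-map≤1 _≟_ b [] _ = z≤n
  length-filter-unique-map≤1 _≟_ b (x ∷ xs) (x∉ ∷ u) with f x ≟ b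
  ... | yes refl = s≤s (≤-reflexive (cong length
          (filter-none (λ v → f v ≟ f x) (All.map ≢-sym (All.map⁻ x∉)))))
  ... | no _ = length-filter-unique-map≤1 _≟_ b xs u

Dominates : {V : Set} → Graph V → List V → Set
Dominates {V} H D = (v : V) → v ∈ D ⊎ Σ[ u ∈ V ] (u ∈ D × Adj H u v)

Universal : {V : Set} → Graph V → V → Set
Universal {V} H u = (x : V) → x ≡ u ⊎ Adj H u x

module _ {V : Set} (H : Graph V) where

  dominates-⊆ : ∀ {D D′} → D ⊆ D′ → Dominates H D → Dominates H D′
  dominates-⊆ D⊆D′ dom v = Sum.map D⊆D′ (Product.map₂ (Product.map₁ D⊆D′)) (dom v)

  γ≡1⇒universal : IsDomNumber H 1 → Σ[ u ∈ V ] Universal H u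
  γ≡1⇒universal (u ∷ [] , ((_ , dom) , _) , _) = u , universal
    where
    universal : Universal H u
    universal x with dom x
    ... | inj₁ (here x≡u) = inj₁ x≡u
    ... | inj₂ (_ , here refl , a) = inj₂ a

  universal⇒γ≡1 : ∀ {u} → Universal H u → IsDomNumber H 1
  universal⇒γ≡1 {u} univ = u ∷ [] , ((All.[] ∷ [] , dominated) , nonempty) , refl
    where
    dominated : Dominates H (u ∷ [])
    dominated x = Sum.map here (λ a → u , here refl , a) (univ x)
    nonempty : (D : List V) → Dominating H D → 1 ≤ length D
    nonempty [] (_ , dom) with dom u
    ... | inj₁ ()
    ... | inj₂ (_ , () , _)
    nonempty (_ ∷ _) _ = s≤s z≤n

  module _ (_≟_ : DecidableEquality V) where

    minDominating≤ : ∀ {I D} → MinDominating H I → Dominates H D → length I ≤ length D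
    minDominating≤ {D = D} (_ , min) dom =
      ≤-trans (min _ (UniqueDec.deduplicate-! _≟_ D , dominates-⊆ (∈-deduplicate⁺ _≟_) dom))
              (length-deduplicate _≟_ D)

    minDominating-unique : ∀ {I D} → MinDominating H I → Dominates H D →
                           length D ≤ length I → Unique D
    minDominating-unique {I} {D} minI dom D≤I with unique⊎shorter-superset _≟_ D
    ... | inj₁ u = u
    ... | inj₂ (D′ , D⊆D′ , D′<D) = ⊥-elim (<-irrefl refl I<I)
      where
      open ≤-Reasoning
      I<I : length I < length I
      I<I = begin-strict
        length I  ≤⟨ minDominating≤ minI (dominates-⊆ D⊆D′ dom) ⟩
        length D′ <⟨ D′<D ⟩
        length D  ≤⟨ D≤I ⟩
        length I  ∎

module LexProduct {n : ℕ} {m : Fin n → ℕ} (G : Graph (Fin n))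
                  (F : (i : Fin n) → Graph (Fin (m i))) (point : (i : Fin n) → Fin (m i)) where

  H : Graph (LexV n m)
  H = Lex G F

  project-dominates : ∀ {D} → Dominates H D → Dominates G (map proj₁ D)
  project-dominates dom i with dom (i , point i)
  ... | inj₁ p = inj₁ (∈-map⁺ proj₁ p)
  ... | inj₂ (_ , p , inner _) = inj₁ (∈-map⁺ proj₁ p)
  ... | inj₂ ((j , _) , p , outer a) = inj₂ (j , ∈-map⁺ proj₁ p , a)

  minDominating≤lex : ∀ {I D} → MinDominating G I → Dominating H D → length I ≤ length D
  minDominating≤lex {D = D} minI (_ , dom) =
    ≤-trans (minDominating≤ G Fin._≟_ minI (project-dominates dom)) (≤-reflexive (length-map proj₁ D))

  project-unique : ∀ {I D} → MinDominating G I → Dominating H D →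
                   length D ≤ length I → Unique (map proj₁ D)
  project-unique {D = D} minI (_ , dom) D≤I =
    minDominating-unique G Fin._≟_ minI (project-dominates dom)
      (≤-trans (≤-reflexive (length-map proj₁ D)) D≤I)

  unique-in-fibre : ∀ {D : List (LexV n m)} {j} {x d : Fin (m j)} →
                    Unique (map proj₁ D) → (j , x) ∈ D → (j , d) ∈ D → x ≡ d
  unique-in-fibre u jx∈D jd∈D = ,-injectiveʳ (unique-map⇒injectiveOn proj₁ u jx∈D jd∈D refl)

  isolated-fibre-universal : ∀ {D j d} → Dominating H D → Unique (map proj₁ D) → (j , d) ∈ D →
                             IsolatedIn G (map proj₁ D) j → Universal (F j) d
  isolated-fibre-universal {j = j} (_ , dom) u jd∈D (_ , isolated) x with dom (j , x)
  ... | inj₁ jx∈D = inj₁ (unique-in-fibre u jx∈D jd∈D)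
  ... | inj₂ (_ , jy∈D , inner a) = inj₂ (subst (λ y → Adj (F j) y x) (unique-in-fibre u jy∈D jd∈D) a)
  ... | inj₂ ((k , _) , kz∈D , outer a) = ⊥-elim (isolated k (∈-map⁺ proj₁ kz∈D) (sym G a))

  projection-minDominating : ∀ {I D} → MinDominating G I → Dominating H D → length D ≤ length I →
    MinDominating G (map proj₁ D) × ((j : Fin n) → IsolatedIn G (map proj₁ D) j → IsDomNumber (F j) 1)
  projection-minDominating {I} {D} minI domD D≤I =
    ((u , project-dominates (proj₂ domD)) , minimum) , isolated-γ≡1
    where
    u : Unique (map proj₁ D)
    u = project-unique minI domD D≤I
    minimum : (D′ : List (Fin n)) → Dominating G D′ → length (map proj₁ D) ≤ length D′
    minimum D′ domD′ = ≤-trans (≤-reflexive (length-map proj₁ D)) (≤-trans D≤I (proj₂ minI D′ domD′))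
    isolated-γ≡1 : (j : Fin n) → IsolatedIn G (map proj₁ D) j → IsDomNumber (F j) 1
    isolated-γ≡1 j isolated@(j∈ , _) with ∈-map⁻ proj₁ j∈
    ... | (_ , d) , jd∈D , refl = universal⇒γ≡1 (F j) (isolated-fibre-universal domD u jd∈D isolated)

  HasNeighbourIn : List (Fin n) → Fin n → Set
  HasNeighbourIn I j = Σ[ k ∈ Fin n ] (k ∈ I × Adj G j k)

  Representative : List (Fin n) → Fin n → Set
  Representative I j = Σ[ d ∈ Fin (m j) ] (HasNeighbourIn I j ⊎ Universal (F j) d)

  lift : (I : List (Fin n)) → (∀ {j} → j ∈ I → Representative I j) → List (LexV n m)
  lift I rep = mapWith∈ I (λ {j} p → j , proj₁ (rep p))

  module _ {I : List (Fin n)} (rep : ∀ {j} → j ∈ I → Representative I j) where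

    map-proj₁-lift : map proj₁ (lift I rep) ≡ I
    map-proj₁-lift = trans (map-mapWith∈ I _ proj₁) (mapWith∈-id I)

    length-lift : length (lift I rep) ≡ length I
    length-lift = SetoidMembership.length-mapWith∈ (setoid (Fin n)) I

    ∈-lift : ∀ {j} (p : j ∈ I) → (j , proj₁ (rep p)) ∈ lift I rep
    ∈-lift p = Any.mapWith∈⁺ _ (_ , p , refl)

    lift-dominating : Dominating G I → Dominating H (lift I rep)
    lift-dominating (uniqueI , domI) = map⁻ (subst Unique (≡-sym map-proj₁-lift) uniqueI) , dominated
      where
      dominated : Dominates H (lift I rep)
      dominated (i , x) with domI i
      ... | inj₂ (k , k∈I , a) = inj₂ (_ , ∈-lift k∈I , outer a)
      ... | inj₁ i∈I with rep i∈I | ∈-lift i∈I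
      ...   | _ , inj₁ (k , k∈I , a) | _ = inj₂ (_ , ∈-lift k∈I , outer (sym G a))
      ...   | d , inj₂ univ | id∈ with univ x
      ...     | inj₁ refl = inj₁ id∈
      ...     | inj₂ a = inj₂ (_ , id∈ , inner a)

  representative : ∀ {I} → ((j : Fin n) → IsolatedIn G I j → IsDomNumber (F j) 1) →
                   ∀ {j} → j ∈ I → Dec (HasNeighbourIn I j) → Representative I j
  representative _ {j} _ (yes neighbour) = point j , inj₁ neighbour
  representative isolated-γ≡1 {j} j∈I (no ¬neighbour) =
    Product.map₂ inj₂
      (γ≡1⇒universal (F j) (isolated-γ≡1 j (j∈I , λ k k∈I a → ¬neighbour (k , k∈I , a))))

  -- HasNeighbourIn is undecidable for an arbitrary adjacency relation, but the goal is a
  -- decidable inequality, so all n instances of excluded middle may be assumed at once.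
  minDominating-lift≤ : ∀ {I D} → MinDominating H D → Dominating G I →
    ((j : Fin n) → IsolatedIn G I j → IsDomNumber (F j) 1) → length D ≤ length I
  minDominating-lift≤ {I} {D} (_ , minD) domI isolated-γ≡1 =
    decidable-stable (length D ≤? length I)
      (¬¬-map bound (sequence (RawMonad.rawApplicative ¬¬-Monad) (λ j → ¬¬-excluded-middle)))
    where
    bound : ((j : Fin n) → Dec (HasNeighbourIn I j)) → length D ≤ length I
    bound neighbour? = ≤-trans (minD _ (lift-dominating rep domI)) (≤-reflexive (length-lift rep))
      where
      rep : ∀ {j} → j ∈ I → Representative I j
      rep {j} j∈I = representative isolated-γ≡1 j∈I (neighbour? j)

theorem2p2 : (n : ℕ) → 2 ≤ n → (G : Graph (Fin n)) → Connected G →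
    (m : Fin n → ℕ) → ((i : Fin n) → 1 ≤ m i) →
    (F : (i : Fin n) → Graph (Fin (m i))) →
    (k l : ℕ) → IsDomNumber G k → IsDomNumber (Lex G F) l →
    (k ≤ l)
    × ((k ≡ l) ⇔ (Σ[ I ∈ List (Fin n) ] (MinDominating G I
          × ((j : Fin n) → IsolatedIn G I j → IsDomNumber (F j) 1))))
    × (k ≡ l → (D : List (LexV n m)) → MinDominating (Lex G F) D →
          (i : Fin n) → length (slice i D) ≤ 1)
theorem2p2 n _ G _ m m≥1 F .(length I) .(length D) (I , minI , refl) (D , minD , refl) =
  minDominating≤lex minI (proj₁ minD) , mk⇔ forward backward , slices≤1
  where
  open LexProduct G F (λ i → fromℕ< (m≥1 i))
  Witness : Set
  Witness = Σ[ J ∈ List (Fin n) ] (MinDominating G J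
              × ((j : Fin n) → IsolatedIn G J j → IsDomNumber (F j) 1))
  forward : length I ≡ length D → Witness
  forward I≡D = map proj₁ D , projection-minDominating minI (proj₁ minD) (≤-reflexive (≡-sym I≡D))
  backward : Witness → length I ≡ length D
  backward (J , minJ , isolated-γ≡1) =
    ≤-antisym (minDominating≤lex minI (proj₁ minD))
              (≤-trans (minDominating-lift≤ minD (proj₁ minJ) isolated-γ≡1) (proj₂ minJ I (proj₁ minI)))
  slices≤1 : length I ≡ length D → (D′ : List (LexV n m)) → MinDominating (Lex G F) D′ →
             (i : Fin n) → length (slice i D′) ≤ 1
  slices≤1 I≡D D′ (domD′ , minD′) i = length-filter-unique-map≤1 proj₁ Fin._≟_ i D′
    (project-unique minI domD′ (≤-trans (minD′ D (proj₁ minD)) (≤-reflexive (≡-sym I≡D))))
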